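{- For every even integer $r\ge 6$ there exists an $r$-regular graph of even order that has an $(r-1,1)$-coloring but has no $\{r-1,1\}$-factor.
   Context: All graphs are finite, undirected pseudographs (multiple edges and loops allowed; a loop contributes $2$ to the degree). An $(r-1,1)$-coloring of an $r$-regular graph is an edge-coloring using at least two colors such that every vertex is incident to exactly $r-1$ edges of one color and exactly $1$ edge of a different color. An $\{r-1,1\}$-factor is a spanning subgraph in which every vertex has degree $r-1$ or $1$. -}

module Defs where

open import Data.Nat using (ℕ; _+_; _∸_)
open import Data.Fin using (Fin; _≟_)
open import Data.List using (List; map; allFin)
open import Data.Nat.ListAction using (sum)
open import Data.Product using (_×_; _,_; proj₁; proj₂; Σ; ∃)
open import Data.Sum using (_⊎_)
open import Data.Bool using (Bool; true; false; if_then_else_)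
open import Relation.Nullary using (¬_; does)
open import Relation.Binary.PropositionalEquality using (_≡_)

-- A finite undirected pseudograph: vertices Fin n, edges Fin m,
-- each edge has an (unordered) pair of endpoints; loops (u , u) and
-- parallel edges are allowed.
record Graph : Set where
  field
    n    : ℕ
    m    : ℕ
    ends : Fin m → Fin n × Fin n
open Graph public

incid : (G : Graph) → Fin (n G) → Fin (m G) → ℕ
incid G v e =
  (if does (proj₁ (ends G e) ≟ v) then 1 else 0) +
  (if does (proj₂ (ends G e) ≟ v) then 1 else 0)

degIn : (G : Graph) → (Fin (m G) → Bool) → Fin (n G) → ℕ
degIn G S v = sum (map (λ e → if S e then incid G v e else 0) (allFin (m G)))

deg : (G : Graph) → Fin (n G) → ℕ
deg G = degIn G (λ _ → true)

Regular : ℕ → Graph → Set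
Regular r G = ∀ v → deg G v ≡ r

colourClass : (G : Graph) → (Fin (m G) → ℕ) → ℕ → Fin (m G) → Bool
colourClass G c a e = does (Data.Nat._≟_ (c e) a)

-- (r-1,1)-colouring: at least two colours are used, and every vertex v
-- has exactly r-1 incident edges of some colour a and exactly 1 incident
-- edge of a different colour b (incidences counted with multiplicity,
-- a loop counting twice, as in the degree).
IsR11Colouring : ℕ → (G : Graph) → (Fin (m G) → ℕ) → Set
IsR11Colouring r G c =
  (Σ (Fin (m G)) λ e → Σ (Fin (m G)) λ e' → ¬ (c e ≡ c e')) ×
  (∀ v → Σ ℕ λ a → Σ ℕ λ b → ¬ (a ≡ b) ×
     (degIn G (colourClass G c a) v ≡ r ∸ 1) ×
     (degIn G (colourClass G c b) v ≡ 1))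

HasR11Colouring : ℕ → Graph → Set
HasR11Colouring r G = Σ (Fin (m G) → ℕ) λ c → IsR11Colouring r G c

IsR11Factor : ℕ → (G : Graph) → (Fin (m G) → Bool) → Set
IsR11Factor r G S = ∀ v → (degIn G S v ≡ r ∸ 1) ⊎ (degIn G S v ≡ 1)

HasR11Factor : ℕ → Graph → Set
HasR11Factor r G = Σ (Fin (m G) → Bool) λ S → IsR11Factor r G S

module Submission where

-- The graph has a hub v0 lying on two 4-cycles v0v1v2v3 and v0v4v5v6 and on a
-- digon v0v7; loops pad every degree up to r = 6 + 2p (p at the hub, p + 2 at
-- the other vertices). Both r − 1 and 1 are odd and loops contribute evenly, so
-- a {r−1,1}-factor picks exactly one of the two non-loop edges at every rim
-- vertex. Along a 4-cycle these choices alternate, hence each cycle and the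
-- digon contribute exactly one edge at the hub, whose factor degree is 3 plus
-- at most 2p: neither 1 nor 5 + 2p. Colouring each cycle 0,1,2,0 from the hub,
-- the digon 0,1 and the loops 0 (1 at v2 and v5) is an (r−1,1)-colouring.

open import Defs
open import Data.Nat using (ℕ; _≤_)
open import Data.Nat.Divisibility using (_∣_)
open import Data.Product using (Σ; _×_)
open import Relation.Nullary using (¬_)

open import Data.Bool using (Bool; true; false; not; _∧_; if_then_else_)
open import Data.Bool.Properties using (not-involutive)
open import Data.Empty using (⊥; ⊥-elim)
open import Data.Fin using (Fin; zero; suc; #_; _≟_; splitAt; _↑ʳ_)
open import Data.List using (List; []; _∷_; _++_; map; filter; length; lookup; tabulate)
open import Data.List.Properties using (map-tabulate)
open import Data.Nat using (zero; suc; _+_; _*_; z≤n; s≤s)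
open import Data.Nat.Divisibility using (divides)
open import Data.Nat.ListAction using (sum)
open import Data.Nat.Properties
  using (+-assoc; +-cancelˡ-≡; *-comm; *-distribˡ-+; +-mono-≤; *-monoʳ-≤; ≤-trans; n≤1+n; 1+n≰n; even≢odd)
open import Data.Nat.Solver using (module +-*-Solver)
open import Data.Product using (_,_; proj₁; ∃-syntax)
open import Data.Sum using (_⊎_; inj₁; inj₂; [_,_]′)
open import Function using (_∘_)
open import Relation.Nullary using (does; yes; no)
open import Relation.Binary.PropositionalEquality
  using (_≡_; refl; sym; trans; cong; cong₂; subst; module ≡-Reasoning)

open ≡-Reasoning

toℕ : Bool → ℕ
toℕ false = 0
toℕ true  = 1

toℕ≤1 : ∀ b → toℕ b ≤ 1
toℕ≤1 false = z≤n
toℕ≤1 true  = s≤s z≤n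

toℕ-+-not : ∀ a x → toℕ a + (toℕ (not a) + x) ≡ suc x
toℕ-+-not false x = refl
toℕ-+-not true  x = refl

fromEdges : ∀ {k} → List (Fin k × Fin k) → Graph
fromEdges {k} es = record { n = k ; m = length es ; ends = lookup es }

-- Each endpoint is tested before the selection, so that for concrete edges and
-- a concrete vertex the degree normalises to the sum of the selected incident edges.
degInEdges : ∀ {k} (es : List (Fin k × Fin k)) → (Fin (length es) → Bool) → Fin k → ℕ
degInEdges []            S v = 0
degInEdges ((x , y) ∷ es) S v =
  toℕ (does (x ≟ v) ∧ S zero) + (toℕ (does (y ≟ v) ∧ S zero) + degInEdges es (S ∘ suc) v)

selected-incidence : ∀ s a b →
  (if s then (if a then 1 else 0) + (if b then 1 else 0) else 0) ≡ toℕ (a ∧ s) + toℕ (b ∧ s)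
selected-incidence false false false = refl
selected-incidence false false true  = refl
selected-incidence false true  false = refl
selected-incidence false true  true  = refl
selected-incidence true  false false = refl
selected-incidence true  false true  = refl
selected-incidence true  true  false = refl
selected-incidence true  true  true  = refl

degIn-fromEdges : ∀ {k} (es : List (Fin k × Fin k)) S v → degIn (fromEdges es) S v ≡ degInEdges es S v
degIn-fromEdges []             S v = refl
degIn-fromEdges ((x , y) ∷ es) S v = begin
    h zero + sum (map h (tabulate suc))
  ≡⟨ cong₂ _+_ (selected-incidence (S zero) (does (x ≟ v)) (does (y ≟ v))) (cong sum shift) ⟩
    (hitˣ + hitʸ) + degIn (fromEdges es) (S ∘ suc) v
  ≡⟨ +-assoc hitˣ hitʸ _ ⟩
    hitˣ + (hitʸ + degIn (fromEdges es) (S ∘ suc) v)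
  ≡⟨ cong (λ t → hitˣ + (hitʸ + t)) (degIn-fromEdges es (S ∘ suc) v) ⟩
    degInEdges ((x , y) ∷ es) S v
  ∎
  where
  hitˣ hitʸ : ℕ
  hitˣ = toℕ (does (x ≟ v) ∧ S zero)
  hitʸ = toℕ (does (y ≟ v) ∧ S zero)
  h : Fin (suc (length es)) → ℕ
  h e = if S e then incid (fromEdges ((x , y) ∷ es)) v e else 0
  shift : map h (tabulate suc) ≡ map (h ∘ suc) (tabulate (λ i → i))
  shift = trans (map-tabulate suc h) (sym (map-tabulate (λ i → i) (h ∘ suc)))

loops : ∀ {k} → List (Fin k) → List (Fin k × Fin k)
loops = map λ u → u , u

occurrences : ∀ {k} → Fin k → List (Fin k) → ℕ
occurrences v = length ∘ filter (_≟ v)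

double-+ : ∀ x c → x + (x + 2 * c) ≡ 2 * (x + c)
double-+ = solve 2 (λ x c → x :+ (x :+ con 2 :* c) := con 2 :* (x :+ c)) refl
  where open +-*-Solver

degInEdges-loops : ∀ {k} (us : List (Fin k)) S v →
  ∃[ c ] degInEdges (loops us) S v ≡ 2 * c × c ≤ occurrences v us
degInEdges-loops []       S v = 0 , refl , z≤n
degInEdges-loops (u ∷ us) S v with degInEdges-loops us (S ∘ suc) v | u ≟ v
... | c , eq , c≤ | yes refl =
  toℕ (S zero) + c
  , trans (cong (λ t → toℕ (S zero) + (toℕ (S zero) + t)) eq) (double-+ (toℕ (S zero)) c)
  , +-mono-≤ (toℕ≤1 (S zero)) c≤
... | c , eq , c≤ | no _ = c , eq , c≤

degInEdges-loops-all : ∀ {k} (g : Fin k → Bool) us v → g v ≡ true →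
  degInEdges (loops us) (λ i → g (proj₁ (lookup (loops us) i))) v ≡ 2 * occurrences v us
degInEdges-loops-all g []       v gv = refl
degInEdges-loops-all g (u ∷ us) v gv with u ≟ v
... | yes refl rewrite gv = trans (cong (λ t → suc (suc t)) (degInEdges-loops-all g us v gv))
                                  (sym (*-distribˡ-+ 2 1 (occurrences v us)))
... | no _ = degInEdges-loops-all g us v gv

degInEdges-loops-none : ∀ {k} (g : Fin k → Bool) us v → g v ≡ false →
  degInEdges (loops us) (λ i → g (proj₁ (lookup (loops us) i))) v ≡ 0
degInEdges-loops-none g []       v gv = refl
degInEdges-loops-none g (u ∷ us) v gv with u ≟ v
... | yes refl rewrite gv = degInEdges-loops-none g us v gv
... | no _ = degInEdges-loops-none g us v gv

odd⇒complementary : ∀ a b c d → toℕ a + (toℕ b + 2 * c) ≡ suc (2 * d) → b ≡ not a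
odd⇒complementary false false c d eq = ⊥-elim (even≢odd c d eq)
odd⇒complementary false true  c d _  = refl
odd⇒complementary true  false c d _  = refl
odd⇒complementary true  true  c d eq = ⊥-elim (even≢odd (suc c) d (trans (*-distribˡ-+ 2 1 c) eq))

alternating : ∀ {a b c d} → b ≡ not a → c ≡ not b → d ≡ not c → d ≡ not a
alternating {a} refl refl refl = cong not (not-involutive a)

complementary-pairs : ∀ {a b a′ b′ a″ b″} x → b ≡ not a → b′ ≡ not a′ → b″ ≡ not a″ →
  toℕ a + (toℕ b + (toℕ a′ + (toℕ b′ + (toℕ a″ + (toℕ b″ + x))))) ≡ 3 + x
complementary-pairs {a} {_} {a′} {_} {a″} x refl refl refl =
  trans (toℕ-+-not a _) (cong suc (trans (toℕ-+-not a′ _) (cong suc (toℕ-+-not a″ x))))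

r11-degree-odd : ∀ p {x} → (x ≡ 5 + 2 * p) ⊎ (x ≡ 1) → ∃[ d ] x ≡ suc (2 * d)
r11-degree-odd p (inj₁ eq) = 2 + p , trans eq (cong suc (sym (*-distribˡ-+ 2 2 p)))
r11-degree-odd p (inj₂ eq) = 0 , eq

hub-degree-impossible : ∀ {c p} → c ≤ p → (3 + 2 * c ≡ 5 + 2 * p) ⊎ (3 + 2 * c ≡ 1) → ⊥
hub-degree-impossible {c} {p} c≤p (inj₁ eq) =
  1+n≰n (≤-trans (n≤1+n (suc (2 * p))) (subst (_≤ 2 * p) (+-cancelˡ-≡ 3 _ _ eq) (*-monoʳ-≤ 2 c≤p)))
hub-degree-impossible c≤p (inj₂ ())

pattern v0 = zero
pattern v1 = suc zero
pattern v2 = suc (suc zero)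
pattern v3 = suc (suc (suc zero))
pattern v4 = suc (suc (suc (suc zero)))
pattern v5 = suc (suc (suc (suc (suc zero))))
pattern v6 = suc (suc (suc (suc (suc (suc zero)))))
pattern v7 = suc (suc (suc (suc (suc (suc (suc zero))))))

rim : List (Fin 8)
rim = v1 ∷ v2 ∷ v3 ∷ v4 ∷ v5 ∷ v6 ∷ v7 ∷ []

loopVertices : ℕ → List (Fin 8)
loopVertices zero    = rim ++ rim
loopVertices (suc p) = v0 ∷ rim ++ loopVertices p

loopMultiplicity : Fin 8 → ℕ
loopMultiplicity v0      = 0
loopMultiplicity (suc _) = 2

occurrences-rim : ∀ (i : Fin 7) us → occurrences (suc i) (rim ++ us) ≡ suc (occurrences (suc i) us)
occurrences-rim zero                                      us = refl
occurrences-rim (suc zero)                                us = refl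
occurrences-rim (suc (suc zero))                          us = refl
occurrences-rim (suc (suc (suc zero)))                    us = refl
occurrences-rim (suc (suc (suc (suc zero))))              us = refl
occurrences-rim (suc (suc (suc (suc (suc zero)))))        us = refl
occurrences-rim (suc (suc (suc (suc (suc (suc zero)))))) us = refl

occurrences-loopVertices : ∀ p v → occurrences v (loopVertices p) ≡ loopMultiplicity v + p
occurrences-loopVertices zero    v0      = refl
occurrences-loopVertices zero    (suc i) = trans (occurrences-rim i rim) (cong suc (occurrences-rim i []))
occurrences-loopVertices (suc p) v0      = cong suc (occurrences-loopVertices p v0)
occurrences-loopVertices (suc p) (suc i) =
  trans (occurrences-rim i (loopVertices p)) (cong suc (occurrences-loopVertices p (suc i)))

coreEdges : List (Fin 8 × Fin 8)
coreEdges = (v0 , v1) ∷ (v1 , v2) ∷ (v2 , v3) ∷ (v3 , v0)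
          ∷ (v0 , v4) ∷ (v4 , v5) ∷ (v5 , v6) ∷ (v6 , v0)
          ∷ (v0 , v7) ∷ (v0 , v7) ∷ []

coreColours : List ℕ
coreColours = 0 ∷ 1 ∷ 2 ∷ 0 ∷ 0 ∷ 1 ∷ 2 ∷ 0 ∷ 0 ∷ 1 ∷ []

loopColour : Fin 8 → ℕ
loopColour v2 = 1
loopColour v5 = 1
loopColour _  = 0

edges : ℕ → List (Fin 8 × Fin 8)
edges p = coreEdges ++ loops (loopVertices p)

graph : ℕ → Graph
graph p = fromEdges (edges p)

colouring : ∀ p → Fin (m (graph p)) → ℕ
colouring p e =
  [ lookup coreColours , loopColour ∘ proj₁ ∘ lookup (loops (loopVertices p)) ]′ (splitAt 10 e)

loopDegIn : ∀ p → (Fin (length (loops (loopVertices p))) → Bool) → Fin 8 → ℕ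
loopDegIn p = degInEdges (loops (loopVertices p))

graph-regular : ∀ p → Regular (6 + 2 * p) (graph p)
graph-regular p v = trans (degIn-fromEdges (edges p) (λ _ → true) v) (byVertex v)
  where
  allLoops : ∀ v → loopDegIn p (λ _ → true) v ≡ 2 * (loopMultiplicity v + p)
  allLoops v = trans (degInEdges-loops-all (λ _ → true) (loopVertices p) v refl)
                     (cong (2 *_) (occurrences-loopVertices p v))
  rimVertex : ∀ i → 2 + loopDegIn p (λ _ → true) (suc i) ≡ 6 + 2 * p
  rimVertex i = cong (2 +_) (trans (allLoops (suc i)) (*-distribˡ-+ 2 2 p))
  byVertex : ∀ v → degInEdges (edges p) (λ _ → true) v ≡ 6 + 2 * p
  byVertex v0 = cong (6 +_) (allLoops v0)
  byVertex v1 = rimVertex _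
  byVertex v2 = rimVertex _
  byVertex v3 = rimVertex _
  byVertex v4 = rimVertex _
  byVertex v5 = rimVertex _
  byVertex v6 = rimVertex _
  byVertex v7 = rimVertex _

graph-colouring : ∀ p → IsR11Colouring (6 + 2 * p) (graph p) (colouring p)
graph-colouring p = (v0 , v1 , λ ()) , byVertex
  where
  inClass : ℕ → Fin 8 → Bool
  inClass a u = does (loopColour u Data.Nat.≟ a)
  loopsInClass : ℕ → Fin 8 → ℕ
  loopsInClass a = loopDegIn p (λ i → inClass a (proj₁ (lookup (loops (loopVertices p)) i)))
  majority : ∀ a i → inClass a (suc i) ≡ true → suc (loopsInClass a (suc i)) ≡ 5 + 2 * p
  majority a i ga = cong suc (begin
    loopsInClass a (suc i)                    ≡⟨ degInEdges-loops-all (inClass a) (loopVertices p) (suc i) ga ⟩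
    2 * occurrences (suc i) (loopVertices p)  ≡⟨ cong (2 *_) (occurrences-loopVertices p (suc i)) ⟩
    2 * (2 + p)                               ≡⟨ *-distribˡ-+ 2 2 p ⟩
    4 + 2 * p                                 ∎)
  hubLoops : loopsInClass 0 v0 ≡ 2 * p
  hubLoops = trans (degInEdges-loops-all (inClass 0) (loopVertices p) v0 refl)
                   (cong (2 *_) (occurrences-loopVertices p v0))
  minority : ∀ b v → inClass b v ≡ false → suc (loopsInClass b v) ≡ 1
  minority b v gb = cong suc (degInEdges-loops-none (inClass b) (loopVertices p) v gb)
  class : ∀ a v {x} → degInEdges (edges p) (colourClass (graph p) (colouring p) a) v ≡ x →
    degIn (graph p) (colourClass (graph p) (colouring p) a) v ≡ x
  class a v = trans (degIn-fromEdges (edges p) (colourClass (graph p) (colouring p) a) v)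
  byVertex : ∀ v → Σ ℕ λ a → Σ ℕ λ b → ¬ (a ≡ b) ×
    (degIn (graph p) (colourClass (graph p) (colouring p) a) v ≡ 5 + 2 * p) ×
    (degIn (graph p) (colourClass (graph p) (colouring p) b) v ≡ 1)
  byVertex v0 = 0 , 1 , (λ ()) , class 0 v0 (cong (5 +_) hubLoops) , class 1 v0 (minority 1 v0 refl)
  byVertex v1 = 0 , 1 , (λ ()) , class 0 v1 (majority 0 _ refl) , class 1 v1 (minority 1 v1 refl)
  byVertex v2 = 1 , 2 , (λ ()) , class 1 v2 (majority 1 _ refl) , class 2 v2 (minority 2 v2 refl)
  byVertex v3 = 0 , 2 , (λ ()) , class 0 v3 (majority 0 _ refl) , class 2 v3 (minority 2 v3 refl)
  byVertex v4 = 0 , 1 , (λ ()) , class 0 v4 (majority 0 _ refl) , class 1 v4 (minority 1 v4 refl)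
  byVertex v5 = 1 , 2 , (λ ()) , class 1 v5 (majority 1 _ refl) , class 2 v5 (minority 2 v5 refl)
  byVertex v6 = 0 , 2 , (λ ()) , class 0 v6 (majority 0 _ refl) , class 2 v6 (minority 2 v6 refl)
  byVertex v7 = 0 , 1 , (λ ()) , class 0 v7 (majority 0 _ refl) , class 1 v7 (minority 1 v7 refl)

graph-no-factor : ∀ p → ¬ HasR11Factor (6 + 2 * p) (graph p)
graph-no-factor p (S , factor) with degInEdges-loops (loopVertices p) (S ∘ (10 ↑ʳ_)) v0
... | c , hubLoops , c≤ =
  hub-degree-impossible (subst (c ≤_) (occurrences-loopVertices p v0) c≤)
                        (subst (λ x → (x ≡ 5 + 2 * p) ⊎ (x ≡ 1)) hubDegree (factor v0))
  where
  loopPart : Fin 8 → ℕ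
  loopPart = loopDegIn p (S ∘ (10 ↑ʳ_))
  alternates : ∀ v a b → degInEdges (edges p) S v ≡ toℕ a + (toℕ b + loopPart v) → b ≡ not a
  alternates v a b eq with degInEdges-loops (loopVertices p) (S ∘ (10 ↑ʳ_)) v | r11-degree-odd p (factor v)
  ... | c′ , loops≡ , _ | d , odd = odd⇒complementary a b c′ d (begin
    toℕ a + (toℕ b + 2 * c′)       ≡⟨ cong (λ t → toℕ a + (toℕ b + t)) loops≡ ⟨
    toℕ a + (toℕ b + loopPart v)   ≡⟨ eq ⟨
    degInEdges (edges p) S v       ≡⟨ degIn-fromEdges (edges p) S v ⟨
    degIn (graph p) S v            ≡⟨ odd ⟩
    suc (2 * d)                    ∎)
  firstCycle : S (# 3) ≡ not (S (# 0))
  firstCycle = alternating (alternates v1 (S (# 0)) (S (# 1)) refl)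
                           (alternates v2 (S (# 1)) (S (# 2)) refl)
                           (alternates v3 (S (# 2)) (S (# 3)) refl)
  secondCycle : S (# 7) ≡ not (S (# 4))
  secondCycle = alternating (alternates v4 (S (# 4)) (S (# 5)) refl)
                            (alternates v5 (S (# 5)) (S (# 6)) refl)
                            (alternates v6 (S (# 6)) (S (# 7)) refl)
  digon : S (# 9) ≡ not (S (# 8))
  digon = alternates v7 (S (# 8)) (S (# 9)) refl
  hubDegree : degIn (graph p) S v0 ≡ 3 + 2 * c
  hubDegree = begin
    degIn (graph p) S v0        ≡⟨ degIn-fromEdges (edges p) S v0 ⟩
    degInEdges (edges p) S v0   ≡⟨ complementary-pairs (loopPart v0) firstCycle secondCycle digon ⟩
    3 + loopPart v0             ≡⟨ cong (3 +_) hubLoops ⟩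
    3 + 2 * c                   ∎

Counterexample : ℕ → Set
Counterexample r = Σ Graph λ G → Regular r G × 2 ∣ n G × HasR11Colouring r G × ¬ HasR11Factor r G

graph-counterexample : ∀ p → Counterexample (6 + 2 * p)
graph-counterexample p =
  graph p , graph-regular p , divides 4 refl , (colouring p , graph-colouring p) , graph-no-factor p

even≥6⇒∃[p]≡6+2*p : ∀ {r} → 2 ∣ r → 6 ≤ r → ∃[ p ] r ≡ 6 + 2 * p
even≥6⇒∃[p]≡6+2*p (divides (suc (suc (suc p))) refl) _ = p , cong (6 +_) (*-comm p 2)
even≥6⇒∃[p]≡6+2*p (divides 0 refl) ()
even≥6⇒∃[p]≡6+2*p (divides 1 refl) (s≤s (s≤s ()))
even≥6⇒∃[p]≡6+2*p (divides 2 refl) (s≤s (s≤s (s≤s (s≤s ()))))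

theorem10 : (r : ℕ) → 2 ∣ r → 6 ≤ r →
    Σ Graph λ G → Regular r G × 2 ∣ n G × HasR11Colouring r G × ¬ HasR11Factor r G
theorem10 r 2∣r 6≤r with even≥6⇒∃[p]≡6+2*p 2∣r 6≤r
... | p , refl = graph-counterexample p
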